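{- Let $\mathcal T$ be a tableau of order $t+1$ and let $C_i$ be its strongly extremal column. Then the coefficient of $m^i$ in $f_{\mathcal T}$ is zero.
   Context: Let $T=\{1,\dots,t\}$, $\hat T=\{1,\dots,t+1\}$. A diagram of order $t+1$ is a tuple $(h_1,\dots,h_{t+1})$ of non-negative integers, pictured as columns $C_1,\dots,C_{t+1}$ of unit blocks; $B(i,j)$ is the block of $C_i$ at level $j\le h_i$, $R_j$ the set of blocks at level $j$, the height is $\max h_i$. Two distinct columns of height $\ge s$ are neighbours at level $s$ if all columns strictly between have height $<s$. A column is left (resp. right) extremal if it has no neighbour to its left (resp. right) at level equal to its height. Boundary conditions (always imposed): left extremal columns have even or maximal height; right extremal columns have odd or maximal height. The strongly extremal column of a non-empty diagram of height $r$ is the leftmost column of height $r$ if $r$ is odd and the rightmost column of height $r$ if $r$ is even; for the empty diagram it is $C_{t+1}$. Tableau: at each non-empty level $j$ the extremal block of $R_j$ is its rightmost block ($j$ odd) or leftmost ($j$ even), with no entry; $b(i,1)=i$ for non-extremal $B(i,1)$; for $j\ge1$ and non-extremal $B(i,j+1)$, $b(i,j+1)=b(k,j)$ with $C_k$ the left ($j$ odd) resp. right ($j$ even) neighbour of $C_i$ at level $j$. Functions: indeterminates $c_i$ ($i\in T$), $m^i$ ($i\in\hat T$); for $i<j$, $r^i-r^j:=m^i+2m^{i+1}+\dots+2m^{j-1}+m^j$, $r^j-r^i:=-(r^i-r^j)$; $h=-\sum_{i\in T}c_im^i$; for level $s$ with columns of height $\ge s$ indexed $u_1<\dots<u_k$: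 $f_{R_s}=\sum_{i=1}^{k-1}c_{b(u_i,s)}(r^{u_i}-r^{u_{i+1}})$ ($s$ odd), $\sum_{i=2}^kc_{b(u_i,s)}(r^{u_i}-r^{u_{i-1}})$ ($s$ even); $f_{\mathcal T}=h+\sum_{s\ge1}f_{R_s}$, a linear form in the $m^i$ with coefficients in $\mathbb Z[c_1,\dots,c_t]$. -}

module Defs where

open import Data.Nat using (ℕ; zero; suc; _≤_; _<_; _⊔_; _%_; _≤ᵇ_; _<ᵇ_; _≡ᵇ_)
open import Data.Fin using (Fin; toℕ; fromℕ; inject₁)
open import Data.Integer using (ℤ; +_; -_) renaming (_+_ to _+ℤ_)
open import Data.Bool using (Bool; true; false; if_then_else_; _∧_; _∨_)
open import Data.List using (List; []; _∷_; map; foldr; allFin; filterᵇ)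
open import Data.Product using (Σ; _×_; _,_)
open import Data.Sum using (_⊎_)
open import Relation.Binary.PropositionalEquality using (_≡_; _≢_)
open import Relation.Nullary using (¬_)

-- Columns are indexed by Fin n (n = t+1); the paper's column C_i is the
-- element with toℕ = i - 1.  A diagram of order n is its height function.

Diagram : ℕ → Set
Diagram n = Fin n → ℕ

Odd Even : ℕ → Set
Odd  m = m % 2 ≡ 1
Even m = m % 2 ≡ 0

height : ∀ {n} → Diagram n → ℕ
height {n} h = foldr _⊔_ 0 (map h (allFin n))

Between : ∀ {n} → Fin n → Fin n → Fin n → Set
Between i k j = (toℕ i < toℕ j × toℕ j < toℕ k) ⊎ (toℕ k < toℕ j × toℕ j < toℕ i)

Neighbours : ∀ {n} → Diagram n → ℕ → Fin n → Fin n → Set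
Neighbours h s i k =
  i ≢ k × s ≤ h i × s ≤ h k × (∀ j → Between i k j → h j < s)

LeftNbr RightNbr : ∀ {n} → Diagram n → ℕ → Fin n → Fin n → Set
LeftNbr  h s i k = toℕ k < toℕ i × Neighbours h s i k
RightNbr h s i k = toℕ i < toℕ k × Neighbours h s i k

LeftExtremal RightExtremal : ∀ {n} → Diagram n → Fin n → Set
LeftExtremal  h i = ¬ (Σ _ λ k → LeftNbr  h (h i) i k)
RightExtremal h i = ¬ (Σ _ λ k → RightNbr h (h i) i k)

BoundaryConditions : ∀ {n} → Diagram n → Set
BoundaryConditions h =
  ∀ i → (LeftExtremal  h i → Even (h i) ⊎ h i ≡ height h)
      × (RightExtremal h i → Odd  (h i) ⊎ h i ≡ height h)

StronglyExtremal : ∀ {n} → Diagram (suc n) → Fin (suc n) → Set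
StronglyExtremal {n} h i =
    (height h ≡ 0 × i ≡ fromℕ n)
  ⊎ (1 ≤ height h × Odd (height h) × h i ≡ height h
       × (∀ k → toℕ k < toℕ i → h k ≢ height h))
  ⊎ (1 ≤ height h × Even (height h) × h i ≡ height h
       × (∀ k → toℕ i < toℕ k → h k ≢ height h))

ExtremalBlock : ∀ {n} → Diagram n → ℕ → Fin n → Set
ExtremalBlock h j i =
    (Odd j  × j ≤ h i × (∀ k → toℕ i < toℕ k → h k < j))
  ⊎ (Even j × j ≤ h i × (∀ k → toℕ k < toℕ i → h k < j))

FillNbr : ∀ {n} → Diagram n → ℕ → Fin n → Fin n → Set
FillNbr h j i k = (Odd j × LeftNbr h j i k) ⊎ (Even j × RightNbr h j i k)

-- A filling b : (column, level) ↦ entry; the entries b(i,j) are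
-- column indices (values in T, as the rules force).  Only the values on
-- non-extremal blocks are constrained (extremal blocks carry no entry).
record IsFilling {n} (h : Diagram n) (b : Fin n → ℕ → Fin n) : Set where
  field
    level1 : ∀ i → 1 ≤ h i → ¬ ExtremalBlock h 1 i → b i 1 ≡ i
    levelS : ∀ i j k → 1 ≤ j → suc j ≤ h i → ¬ ExtremalBlock h (suc j) i →
             FillNbr h j i k → b i (suc j) ≡ b k j

record Tableau (n : ℕ) : Set where
  field
    heights  : Diagram n
    boundary : BoundaryConditions heights
    entry    : Fin n → ℕ → Fin n
    filling  : IsFilling heights entry

-- Linear forms  Σ_{k,x} F k x · c_k m^x  with integer coefficients.
-- First argument: index k of c_k (a column index, k ∈ T),
-- second argument: index x of m^x.

Form : ℕ → Set
Form n = Fin n → Fin n → ℤ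

0F : ∀ {n} → Form n
0F _ _ = + 0

_⊕_ : ∀ {n} → Form n → Form n → Form n
(F ⊕ G) k x = F k x +ℤ G k x

sumF : ∀ {n} → List (Form n) → Form n
sumF = foldr _⊕_ 0F

_==_ : ∀ {n} → Fin n → Fin n → Bool
a == b = toℕ a ≡ᵇ toℕ b

-- coefficient of m^x in  r^a - r^b = m^a + 2m^{a+1} + … + 2m^{b-1} + m^b  (a < b)
segCoef : ∀ {n} → Fin n → Fin n → Fin n → ℤ
segCoef a b x =
  if (x == a) ∨ (x == b) then + 1
  else if (toℕ a <ᵇ toℕ x) ∧ (toℕ x <ᵇ toℕ b) then + 2
  else + 0

rdiff : ∀ {n} → Fin n → Fin n → Fin n → ℤ
rdiff a b x =
  if toℕ a <ᵇ toℕ b then segCoef a b x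
  else if toℕ b <ᵇ toℕ a then - segCoef b a x
  else + 0

cTimesR : ∀ {n} → Fin n → Fin n → Fin n → Form n
cTimesR k a b k' x = if k' == k then rdiff a b x else + 0

-- h = - Σ_{i ∈ T} c_i m^i   (T = columns 1..t, i.e. all but the last)
hForm : ∀ {t} → Form (suc t)
hForm {t} k x =
  if (k == x) ∧ (toℕ k <ᵇ t) then - (+ 1) else + 0

levelCols : ∀ {n} → Diagram n → ℕ → List (Fin n)
levelCols {n} h s = filterᵇ (λ i → s ≤ᵇ h i) (allFin n)

consec : ∀ {A : Set} → List A → List (A × A)
consec []           = []
consec (x ∷ [])     = []
consec (x ∷ y ∷ xs) = (x , y) ∷ consec (y ∷ xs)

fRow : ∀ {n} → Diagram n → (Fin n → ℕ → Fin n) → ℕ → Form n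
fRow h b s =
  if s % 2 ≡ᵇ 1
  then sumF (map (λ { (u , u') → cTimesR (b u s) u u' }) (consec (levelCols h s)))
  else sumF (map (λ { (u , u') → cTimesR (b u' s) u' u }) (consec (levelCols h s)))

-- Σ_{s=1}^{r} f_{R_s}   (rows above the height are empty)
sumRows : ∀ {n} → Diagram n → (Fin n → ℕ → Fin n) → ℕ → Form n
sumRows h b zero    = 0F
sumRows h b (suc r) = sumRows h b r ⊕ fRow h b (suc r)

fT : ∀ {t} → Tableau (suc t) → Form (suc t)
fT 𝒯 = hForm ⊕ sumRows heights entry (height heights)
  where open Tableau 𝒯

-- Fix c_K (K ∈ T) and the column x.  At a level s ≤ h x the column x
-- occurs among the columns reaching s, and only the two consecutive pairs
-- containing x contribute to the coefficient of c_K m^x in f_{R_s}: the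
-- pair with the left neighbour p and the pair with the right neighbour q.
-- On odd levels these give [c_K] c_{b(p,s)} and [c_K] c_{b(x,s)}, on even
-- levels -[c_K] c_{b(x,s)} and -[c_K] c_{b(q,s)}.  The filling rule
-- b(x,s+1) = b(p,s) (s odd) resp. b(x,s+1) = b(q,s) (s even) makes the
-- left terms of levels s, s+1 (s odd) and the right terms of levels s, s+1
-- (s even) cancel, while h cancels the right term of level 1.  The
-- boundary conditions guarantee that a neighbour present at level s is
-- still present at level s+1 ≤ height.  What survives is the left term of
-- the top level (odd height) or its right term (even height), which is
-- zero because the strongly extremal column has no neighbour on that side.
module Submission where

open import Defs
open import Data.Nat using (ℕ; zero; suc; _+_; _∸_; _≤_; _<_; _≤ᵇ_; _<ᵇ_; z≤n; s≤s; _⊔_; _≤?_; _<?_)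
open import Data.Nat.Properties using (≤-refl; ≤-trans; <-trans; <⇒≤; ≤-antisym; <⇒≱; ≰⇒>; <-cmp; <-irrefl; <-asym; <-≤-trans; ≤-<-trans; ≤-pred; m≤m⊔n; m≤n⊔m; m≤n⇒m<n∨m≡n; ∸-monoʳ-<; +-suc; +-identityʳ; ≤ᵇ⇒≤; ≤⇒≤ᵇ; <ᵇ⇒<; <⇒<ᵇ; ≡ᵇ⇒≡; ≡⇒≡ᵇ)
open import Data.Fin using (Fin; toℕ; inject₁; fromℕ) renaming (zero to fzero; suc to fsuc)
open import Data.Fin.Properties using (toℕ-injective; toℕ<n; any?; toℕ-inject₁; toℕ-fromℕ)
open import Data.Integer using (ℤ; +_; -_) renaming (_+_ to _+ℤ_)
open import Data.Integer.Properties using (+-inverseˡ; +-inverseʳ; +-identityˡ; +-assoc; +-comm) renaming (+-identityʳ to +ℤ-identityʳ)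
open import Data.Bool using (true; false; if_then_else_; T)
open import Data.List using (List; []; _∷_; map; filterᵇ; tabulate)
open import Data.List.Membership.Propositional using (_∈_)
open import Data.List.Membership.Propositional.Properties using (∈-map⁺; ∈-allFin)
open import Data.List.Relation.Unary.Any using (here; there)
open import Data.Product using (Σ; _×_; _,_; proj₁; proj₂)
open import Data.Sum using (_⊎_; inj₁; inj₂)
open import Data.Empty using (⊥; ⊥-elim)
open import Relation.Nullary using (¬_; Dec; yes; no)
open import Relation.Nullary.Decidable using (_×-dec_)
open import Relation.Binary using (tri<; tri≈; tri>)
open import Relation.Binary.PropositionalEquality using (_≡_; _≢_; refl; sym; trans; cong; cong₂; subst; subst₂; module ≡-Reasoning)
open import Function using (_∘_; id)

odd⇒even-suc : ∀ r → Odd r → Even (suc r)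
odd⇒even-suc zero ()
odd⇒even-suc (suc zero) _ = refl
odd⇒even-suc (suc (suc r)) o = odd⇒even-suc r o

even⇒odd-suc : ∀ r → Even r → Odd (suc r)
even⇒odd-suc zero _ = refl
even⇒odd-suc (suc zero) ()
even⇒odd-suc (suc (suc r)) e = even⇒odd-suc r e

odd-even-disjoint : ∀ {r} → Odd r → Even r → ⊥
odd-even-disjoint o e with trans (sym o) e
... | ()

height-bound : ∀ {n} (h : Diagram n) j → h j ≤ height h
height-bound {n} h j = foldr-max (∈-map⁺ h (∈-allFin j))
  where
    foldr-max : ∀ {a} {l : List ℕ} → a ∈ l → a ≤ Data.List.foldr _⊔_ 0 l
    foldr-max {l = y ∷ l} (here refl) = m≤m⊔n y _
    foldr-max {l = y ∷ l} (there a∈l) = ≤-trans (foldr-max a∈l) (m≤n⊔m y _)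

T⇒true : ∀ {b} → T b → b ≡ true
T⇒true {true} _ = refl

¬T⇒false : ∀ {b} → ¬ T b → b ≡ false
¬T⇒false {false} _ = refl
¬T⇒false {true} ¬t = ⊥-elim (¬t _)

<ᵇ-true : ∀ {a c} → a < c → (a <ᵇ c) ≡ true
<ᵇ-true a<c = T⇒true (<⇒<ᵇ a<c)

<ᵇ-false : ∀ {a c} → ¬ a < c → (a <ᵇ c) ≡ false
<ᵇ-false {a} {c} a≮c = ¬T⇒false (a≮c ∘ <ᵇ⇒< a c)

==-refl : ∀ {n} (a : Fin n) → (a == a) ≡ true
==-refl a = T⇒true (≡⇒≡ᵇ (toℕ a) (toℕ a) refl)

==-false : ∀ {n} {a c : Fin n} → toℕ a ≢ toℕ c → (a == c) ≡ false
==-false {a = a} {c} a≢c = ¬T⇒false (a≢c ∘ ≡ᵇ⇒≡ (toℕ a) (toℕ c))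

==⇒≡ : ∀ {n} {a c : Fin n} → (a == c) ≡ true → toℕ a ≡ toℕ c
==⇒≡ {a = a} {c} eq = ≡ᵇ⇒≡ (toℕ a) (toℕ c) (subst T (sym eq) _)

<⇒≢ : ∀ {a c} → a < c → c ≢ a
<⇒≢ a<c c≡a = <-irrefl (sym c≡a) a<c

module SegmentCoefficients {n : ℕ} (x : Fin n) where

  segCoef-outside : ∀ a c → toℕ a < toℕ c → (toℕ c < toℕ x ⊎ toℕ x < toℕ a) →
                    segCoef a c x ≡ + 0
  segCoef-outside a c a<c (inj₁ c<x)
    rewrite ==-false {a = x} {a} (<⇒≢ (<-trans a<c c<x)) | ==-false {a = x} {c} (<⇒≢ c<x)
          | <ᵇ-true (<-trans a<c c<x) | <ᵇ-false (<-asym c<x) = refl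
  segCoef-outside a c a<c (inj₂ x<a)
    rewrite ==-false {a = x} {a} (<⇒≢ x<a ∘ sym) | ==-false {a = x} {c} (<⇒≢ (<-trans x<a a<c) ∘ sym)
          | <ᵇ-false (<-asym x<a) = refl

  segCoef-from : ∀ c → segCoef x c x ≡ + 1
  segCoef-from c rewrite ==-refl x = refl

  segCoef-to : ∀ a → toℕ a < toℕ x → segCoef a x x ≡ + 1
  segCoef-to a a<x rewrite ==-false {a = x} {a} (<⇒≢ a<x) | ==-refl x = refl

  rdiff-ordered : ∀ a c → toℕ a < toℕ c → rdiff a c x ≡ segCoef a c x
  rdiff-ordered a c a<c rewrite <ᵇ-true a<c = refl

  rdiff-reversed : ∀ a c → toℕ a < toℕ c → rdiff c a x ≡ - segCoef a c x
  rdiff-reversed a c a<c rewrite <ᵇ-false (<-asym a<c) | <ᵇ-true a<c = refl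

-- Boundary conditions forbid a left (right) barrier at an odd (even)
-- non-maximal level: a column reaching level r with all columns up to it
-- (from it on) of height ≤ r.  The leftmost (rightmost) column reaching
-- level r would be left (right) extremal of that parity.

module Minimal {A : Set} (_≺_ : A → A → Set) (μ : A → ℕ)
  (μ-mono : ∀ {a c} → a ≺ c → μ a < μ c) (≺-trans : ∀ {a c d} → a ≺ c → c ≺ d → a ≺ d)
  (P : A → Set) (smaller? : ∀ a → Dec (Σ A λ c → c ≺ a × P c)) where

  minimal : ∀ a → P a → Σ A λ m → P m × (m ≡ a ⊎ m ≺ a) × (∀ c → c ≺ m → ¬ P c)
  minimal a pa = search (suc (μ a)) a ≤-refl pa
    where
      search : ∀ f a → μ a < f → P a → Σ A λ m → P m × (m ≡ a ⊎ m ≺ a) × (∀ c → c ≺ m → ¬ P c)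
      search zero a () pa
      search (suc f) a μa<f pa with smaller? a
      ... | no none = a , pa , inj₁ refl , λ c c≺a pc → none (c , c≺a , pc)
      ... | yes (c , c≺a , pc) with search f c (<-≤-trans (μ-mono c≺a) (≤-pred μa<f)) pc
      ...   | m , pm , inj₁ refl , min = m , pm , inj₂ c≺a , min
      ...   | m , pm , inj₂ m≺c , min = m , pm , inj₂ (≺-trans m≺c c≺a) , min

module Extremal {n : ℕ} (h : Diagram n) where

  leftExtremal-at : ∀ r p → r ≤ h p → (∀ k → toℕ k ≤ toℕ p → h k ≤ r) →
                    Σ (Fin n) λ m → h m ≡ r × LeftExtremal h m
  leftExtremal-at r p r≤hp below with
    Minimal.minimal (λ c a → toℕ c < toℕ a) toℕ id <-trans (λ c → r ≤ h c)
      (λ a → any? (λ c → (toℕ c <? toℕ a) ×-dec (r ≤? h c))) p r≤hp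
  ... | m , r≤hm , m≤p , min = m , hm≡r , extremal
    where
      hm≡r : h m ≡ r
      hm≡r = ≤-antisym (below m (≤-of m≤p)) r≤hm
        where
          ≤-of : m ≡ p ⊎ toℕ m < toℕ p → toℕ m ≤ toℕ p
          ≤-of (inj₁ refl) = ≤-refl
          ≤-of (inj₂ m<p) = <⇒≤ m<p
      extremal : LeftExtremal h m
      extremal (k , k<m , _ , _ , hm≤hk , _) = min k k<m (subst (_≤ h k) hm≡r hm≤hk)

  rightExtremal-at : ∀ r p → r ≤ h p → (∀ k → toℕ p ≤ toℕ k → h k ≤ r) →
                     Σ (Fin n) λ m → h m ≡ r × RightExtremal h m
  rightExtremal-at r p r≤hp above with
    Minimal.minimal (λ c a → toℕ a < toℕ c) (λ a → n ∸ toℕ a)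
      (λ {a} {c} c<a → ∸-monoʳ-< c<a (<⇒≤ (toℕ<n a))) (λ c<a d<c → <-trans d<c c<a)
      (λ c → r ≤ h c) (λ a → any? (λ c → (toℕ a <? toℕ c) ×-dec (r ≤? h c))) p r≤hp
  ... | m , r≤hm , p≤m , max = m , hm≡r , extremal
    where
      hm≡r : h m ≡ r
      hm≡r = ≤-antisym (above m (≤-of p≤m)) r≤hm
        where
          ≤-of : m ≡ p ⊎ toℕ p < toℕ m → toℕ p ≤ toℕ m
          ≤-of (inj₁ refl) = ≤-refl
          ≤-of (inj₂ p<m) = <⇒≤ p<m
      extremal : RightExtremal h m
      extremal (k , m<k , _ , _ , hm≤hk , _) = max k m<k (subst (_≤ h k) hm≡r hm≤hk)

  no-odd-left-barrier : BoundaryConditions h → ∀ r p → Odd r → r < height h → r ≤ h p →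
                        ¬ (∀ k → toℕ k ≤ toℕ p → h k ≤ r)
  no-odd-left-barrier bc r p odd r<H r≤hp below
    with leftExtremal-at r p r≤hp below
  ... | m , hm≡r , ext with proj₁ (bc m) ext
  ...   | inj₁ even = odd-even-disjoint {r} odd (subst Even hm≡r even)
  ...   | inj₂ hm≡H = <-irrefl (trans (sym hm≡r) hm≡H) r<H

  no-even-right-barrier : BoundaryConditions h → ∀ r p → Even r → r < height h → r ≤ h p →
                          ¬ (∀ k → toℕ p ≤ toℕ k → h k ≤ r)
  no-even-right-barrier bc r p even r<H r≤hp above
    with rightExtremal-at r p r≤hp above
  ... | m , hm≡r , ext with proj₂ (bc m) ext
  ...   | inj₁ odd = odd-even-disjoint {r} (subst Odd hm≡r odd) even
  ...   | inj₂ hm≡H = <-irrefl (trans (sym hm≡r) hm≡H) r<H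

sumPairs : ∀ {n} → (Fin n → Fin n → ℤ) → List (Fin n) → ℤ
sumPairs φ (u ∷ v ∷ l) = φ u v +ℤ sumPairs φ (v ∷ l)
sumPairs φ _ = + 0

sumF-consec : ∀ {n} (G : Fin n × Fin n → Form n) (K x : Fin n) (l : List (Fin n)) →
              sumF (map G (consec l)) K x ≡ sumPairs (λ u v → G (u , v) K x) l
sumF-consec G K x [] = refl
sumF-consec G K x (u ∷ []) = refl
sumF-consec G K x (u ∷ v ∷ l) = cong (G (u , v) K x +ℤ_) (sumF-consec G K x (v ∷ l))

data LeftView {n} (h : Diagram n) (s : ℕ) (x : Fin n) : Set where
  noLeft  : (∀ k → toℕ k < toℕ x → h k < s) → LeftView h s x
  hasLeft : ∀ p → LeftNbr h s x p → LeftView h s x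

data RightView {n} (h : Diagram n) (s : ℕ) (x : Fin n) : Set where
  noRight  : (∀ k → toℕ x < toℕ k → h k < s) → RightView h s x
  hasRight : ∀ q → RightNbr h s x q → RightView h s x

leftPart : ∀ {n} {h : Diagram n} {s x} → (Fin n → Fin n → ℤ) → LeftView h s x → ℤ
leftPart φ (noLeft _) = + 0
leftPart {x = x} φ (hasLeft p _) = φ p x

rightPart : ∀ {n} {h : Diagram n} {s x} → (Fin n → Fin n → ℤ) → RightView h s x → ℤ
rightPart φ (noRight _) = + 0
rightPart {x = x} φ (hasRight q _) = φ x q

module LevelSum {n : ℕ} (h : Diagram n) (s : ℕ) where

  data Enumerates : ℕ → List (Fin n) → Set where
    done : ∀ {lo} → (∀ j → lo ≤ toℕ j → h j < s) → Enumerates lo []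
    next : ∀ {lo u l} → lo ≤ toℕ u → s ≤ h u → (∀ j → lo ≤ toℕ j → toℕ j < toℕ u → h j < s) →
           Enumerates (suc (toℕ u)) l → Enumerates lo (u ∷ l)

  step-down : ∀ {c} → (∀ j → toℕ j ≡ c → h j < s) → ∀ j → c ≤ toℕ j → (c < toℕ j → h j < s) → h j < s
  step-down low j c≤j after with m≤n⇒m<n∨m≡n c≤j
  ... | inj₁ c<j = after c<j
  ... | inj₂ c≡j = low j (sym c≡j)

  extend : ∀ {c l} → (∀ j → toℕ j ≡ c → h j < s) → Enumerates (suc c) l → Enumerates c l
  extend low (done above) = done λ j c≤j → step-down low j c≤j (above j)
  extend low (next c<u su gap rest) =
    next (<⇒≤ c<u) su (λ j c≤j j<u → step-down low j c≤j λ c<j → gap j c<j j<u) rest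

  Window : ∀ m → ℕ → (Fin m → Fin n) → Set
  Window m c f = (∀ j → toℕ (f j) ≡ c + toℕ j) × c + m ≡ n

  window-head : ∀ {m c f} → Window (suc m) c f → toℕ (f fzero) ≡ c
  window-head (f-index , _) = trans (f-index fzero) (+-identityʳ _)

  window-tail : ∀ {m c f} → Window (suc m) c f → Window m (suc c) (f ∘ fsuc)
  window-tail {m} {c} (f-index , c+m≡n) =
    (λ j → trans (f-index (fsuc j)) (+-suc c (toℕ j))) , trans (sym (+-suc c m)) c+m≡n

  enumerates-window : ∀ m c f → Window m c f → Enumerates c (filterᵇ (λ i → s ≤ᵇ h i) (tabulate f))
  enumerates-window zero c f (_ , c+0≡n) = done λ j c≤j →
    ⊥-elim (<⇒≱ (subst (toℕ j <_) (trans (sym c+0≡n) (+-identityʳ c)) (toℕ<n j)) c≤j)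
  enumerates-window (suc m) c f w with s ≤ᵇ h (f fzero) in reaches
  ... | true = next (subst (c ≤_) (sym (window-head w)) ≤-refl)
                    (≤ᵇ⇒≤ s (h (f fzero)) (subst T (sym reaches) _))
                    (λ j c≤j j<f₀ → ⊥-elim (<⇒≱ (subst (toℕ j <_) (window-head w) j<f₀) c≤j))
                    (subst (λ z → Enumerates (suc z) _) (sym (window-head w))
                      (enumerates-window m (suc c) (f ∘ fsuc) (window-tail w)))
  ... | false = extend low (enumerates-window m (suc c) (f ∘ fsuc) (window-tail w))
    where
      low : ∀ j → toℕ j ≡ c → h j < s
      low j j≡c with toℕ-injective {i = j} {j = f fzero} (trans j≡c (sym (window-head w)))
      ... | refl = ≰⇒> (λ s≤hj → subst T reaches (≤⇒≤ᵇ s≤hj))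

  levelCols-enumerates : Enumerates 0 (levelCols h s)
  levelCols-enumerates = enumerates-window n 0 id ((λ _ → refl) , refl)

  module Split (x : Fin n) (s≤hx : s ≤ h x) (φ : Fin n → Fin n → ℤ)
    (local : ∀ u v → toℕ u < toℕ v → (toℕ v < toℕ x ⊎ toℕ x < toℕ u) → φ u v ≡ + 0) where

    right-of-x : ∀ v l → toℕ x < toℕ v → Enumerates (suc (toℕ v)) l → sumPairs φ (v ∷ l) ≡ + 0
    right-of-x v [] _ _ = refl
    right-of-x v (w ∷ l) x<v (next v<w _ _ rest) =
      cong₂ _+ℤ_ (local v w v<w (inj₂ x<v)) (right-of-x w l (<-trans x<v v<w) rest)

    from-x : ∀ l → Enumerates (suc (toℕ x)) l →
             Σ (RightView h s x) λ rv → sumPairs φ (x ∷ l) ≡ rightPart φ rv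
    from-x [] (done above) = noRight above , refl
    from-x (q ∷ l) (next x<q s≤hq gap rest) =
      hasRight q (x<q , (<⇒≢ x<q ∘ cong toℕ ∘ sym) , s≤hx , s≤hq , between) ,
      trans (cong (φ x q +ℤ_) (right-of-x q l x<q rest)) (+ℤ-identityʳ (φ x q))
      where
        between : ∀ j → Between x q j → h j < s
        between j (inj₁ (x<j , j<q)) = gap j x<j j<q
        between j (inj₂ (q<j , j<x)) = ⊥-elim (<-asym x<q (<-trans q<j j<x))

    left-of-x : ∀ {lo} u l → toℕ u < toℕ x → Enumerates lo (u ∷ l) →
                Σ (Fin n) λ p → LeftNbr h s x p ×
                  Σ (RightView h s x) λ rv → sumPairs φ (u ∷ l) ≡ φ p x +ℤ rightPart φ rv
    left-of-x u [] u<x (next _ _ _ (done above)) = ⊥-elim (<⇒≱ (above x u<x) s≤hx)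
    left-of-x u (v ∷ l) u<x (next _ s≤hu _ (next u<v _ gap rest)) with <-cmp (toℕ v) (toℕ x)
    ... | tri> _ _ x<v = ⊥-elim (<⇒≱ (gap x u<x x<v) s≤hx)
    ... | tri≈ _ v≡x _ with toℕ-injective {i = v} {j = x} v≡x
    ...   | refl with from-x l rest
    ...     | rv , eq = u , (u<x , (<⇒≢ u<x ∘ cong toℕ) , s≤hx , s≤hu , between) , rv , cong (φ u x +ℤ_) eq
      where
        between : ∀ j → Between x u j → h j < s
        between j (inj₁ (x<j , j<u)) = ⊥-elim (<-asym u<x (<-trans x<j j<u))
        between j (inj₂ (u<j , j<x)) = gap j u<j j<x
    left-of-x u (v ∷ l) u<x (next _ _ _ rest@(next u<v _ _ _)) | tri< v<x _ _
      with left-of-x v l v<x rest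
    ... | p , nbr , rv , eq =
      p , nbr , rv , trans (cong₂ _+ℤ_ (local u v u<v (inj₁ v<x)) eq) (+-identityˡ _)

    split-enumeration : ∀ l → Enumerates 0 l →
      Σ (LeftView h s x) λ lv → Σ (RightView h s x) λ rv → sumPairs φ l ≡ leftPart φ lv +ℤ rightPart φ rv
    split-enumeration [] (done above) = ⊥-elim (<⇒≱ (above x z≤n) s≤hx)
    split-enumeration (u ∷ l) e with <-cmp (toℕ u) (toℕ x)
    ... | tri< u<x _ _ with left-of-x u l u<x e
    ...   | p , nbr , rv , eq = hasLeft p nbr , rv , eq
    split-enumeration (u ∷ l) (next _ _ gap rest) | tri≈ _ u≡x _ with toℕ-injective {i = u} {j = x} u≡x
    ...   | refl with from-x l rest
    ...     | rv , eq = noLeft (λ k k<x → gap k z≤n k<x) , rv , trans eq (sym (+-identityˡ _))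
    split-enumeration (u ∷ l) (next _ _ gap rest) | tri> _ _ x<u = ⊥-elim (<⇒≱ (gap x z≤n x<u) s≤hx)

    split : Σ (LeftView h s x) λ lv → Σ (RightView h s x) λ rv →
            sumPairs φ (levelCols h s) ≡ leftPart φ lv +ℤ rightPart φ rv
    split = split-enumeration (levelCols h s) levelCols-enumerates

module Rows {n : ℕ} (h : Diagram n) (b : Fin n → ℕ → Fin n) (K x : Fin n) where
  open SegmentCoefficients x

  κ : Fin n → ℤ
  κ c = if K == c then + 1 else + 0

  oddTerm evenTerm : ℕ → Fin n → Fin n → ℤ
  oddTerm  s u v = cTimesR (b u s) u v K x
  evenTerm s u v = cTimesR (b v s) v u K x

  fRow-odd : ∀ s → Odd s → fRow h b s K x ≡ sumPairs (oddTerm s) (levelCols h s)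
  fRow-odd s odd rewrite odd = sumF-consec _ K x (levelCols h s)

  fRow-even : ∀ s → Even s → fRow h b s K x ≡ sumPairs (evenTerm s) (levelCols h s)
  fRow-even s even rewrite even = sumF-consec _ K x (levelCols h s)

  term-zero : ∀ c a v → rdiff a v x ≡ + 0 → cTimesR c a v K x ≡ + 0
  term-zero c a v eq with K == c
  ... | true = eq
  ... | false = refl

  term-one : ∀ c a v → rdiff a v x ≡ + 1 → cTimesR c a v K x ≡ κ c
  term-one c a v eq = cong (λ z → if K == c then z else + 0) eq

  term-minus-one : ∀ c a v → rdiff a v x ≡ - (+ 1) → cTimesR c a v K x ≡ - κ c
  term-minus-one c a v eq with K == c
  ... | true = eq
  ... | false = refl

  oddTerm-local : ∀ s u v → toℕ u < toℕ v → (toℕ v < toℕ x ⊎ toℕ x < toℕ u) → oddTerm s u v ≡ + 0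
  oddTerm-local s u v u<v away =
    term-zero (b u s) u v (trans (rdiff-ordered u v u<v) (segCoef-outside u v u<v away))

  evenTerm-local : ∀ s u v → toℕ u < toℕ v → (toℕ v < toℕ x ⊎ toℕ x < toℕ u) → evenTerm s u v ≡ + 0
  evenTerm-local s u v u<v away =
    term-zero (b v s) v u (trans (rdiff-reversed u v u<v) (cong -_ (segCoef-outside u v u<v away)))

  oddTerm-left : ∀ s p → toℕ p < toℕ x → oddTerm s p x ≡ κ (b p s)
  oddTerm-left s p p<x = term-one (b p s) p x (trans (rdiff-ordered p x p<x) (segCoef-to p p<x))

  oddTerm-right : ∀ s q → toℕ x < toℕ q → oddTerm s x q ≡ κ (b x s)
  oddTerm-right s q x<q = term-one (b x s) x q (trans (rdiff-ordered x q x<q) (segCoef-from q))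

  evenTerm-left : ∀ s p → toℕ p < toℕ x → evenTerm s p x ≡ - κ (b x s)
  evenTerm-left s p p<x =
    term-minus-one (b x s) x p (trans (rdiff-reversed p x p<x) (cong -_ (segCoef-to p p<x)))

  evenTerm-right : ∀ s q → toℕ x < toℕ q → evenTerm s x q ≡ - κ (b q s)
  evenTerm-right s q x<q =
    term-minus-one (b q s) q x (trans (rdiff-reversed x q x<q) (cong -_ (segCoef-from q)))

  oddLevel : ∀ s → Odd s → s ≤ h x → Σ (LeftView h s x) λ lv → Σ (RightView h s x) λ rv →
             fRow h b s K x ≡ leftPart (oddTerm s) lv +ℤ rightPart (oddTerm s) rv
  oddLevel s odd s≤hx with LevelSum.Split.split h s x s≤hx (oddTerm s) (oddTerm-local s)
  ... | lv , rv , eq = lv , rv , trans (fRow-odd s odd) eq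

  evenLevel : ∀ s → Even s → s ≤ h x → Σ (LeftView h s x) λ lv → Σ (RightView h s x) λ rv →
              fRow h b s K x ≡ leftPart (evenTerm s) lv +ℤ rightPart (evenTerm s) rv
  evenLevel s even s≤hx with LevelSum.Split.split h s x s≤hx (evenTerm s) (evenTerm-local s)
  ... | lv , rv , eq = lv , rv , trans (fRow-even s even) eq

-- Integer bookkeeping for one step of the telescoping sum: adding a level
-- V = L + R whose part L cancels the pending term O leaves R
telescope-step : ∀ {O} a S V L R → a +ℤ S ≡ O → V ≡ L +ℤ R → O +ℤ L ≡ + 0 → a +ℤ (S +ℤ V) ≡ R
telescope-step {O} a S V L R a+S≡O V≡L+R O+L≡0 = begin
  a +ℤ (S +ℤ V)   ≡⟨ sym (+-assoc a S V) ⟩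
  (a +ℤ S) +ℤ V   ≡⟨ cong₂ _+ℤ_ a+S≡O V≡L+R ⟩
  O +ℤ (L +ℤ R)   ≡⟨ sym (+-assoc O L R) ⟩
  (O +ℤ L) +ℤ R   ≡⟨ cong (_+ℤ R) O+L≡0 ⟩
  + 0 +ℤ R        ≡⟨ +-identityˡ R ⟩
  R               ∎
  where open ≡-Reasoning

module Telescoping (t : ℕ) (𝒯 : Tableau (suc t)) (k : Fin t) (x : Fin (suc t)) where
  open Tableau 𝒯 renaming (heights to h; entry to b)
  open IsFilling filling
  open Extremal h

  K : Fin (suc t)
  K = inject₁ k

  H : ℕ
  H = height h

  open Rows h b K x

  -- h = -Σ_{i∈T} c_i m^i contributes -[c_K] c_x, since K ∈ T
  hForm-at : hForm K x ≡ - κ x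
  hForm-at with K == x
  ... | false = refl
  ... | true rewrite <ᵇ-true (subst (_< t) (sym (toℕ-inject₁ k)) (toℕ<n k)) = refl

  -- the empty diagram: x is the last column, which is not in T
  empty-diagram : H ≡ 0 → x ≡ fromℕ t → fT 𝒯 K x ≡ + 0
  empty-diagram H≡0 refl rewrite H≡0 = trans (+ℤ-identityʳ (hForm K x)) (trans hForm-at (cong -_ κ-last))
    where
      K≢last : toℕ K ≢ toℕ (fromℕ t)
      K≢last eq = <-irrefl (trans (sym (toℕ-inject₁ k)) (trans eq (toℕ-fromℕ t))) (toℕ<n k)

      κ-last : κ (fromℕ t) ≡ + 0
      κ-last rewrite ==-false {a = K} {fromℕ t} K≢last = refl

  Pending : ℕ → ℤ → Set
  Pending r O = (Odd r × Σ (LeftView h r x) λ lv → O ≡ leftPart (oddTerm r) lv)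
              ⊎ (Even r × Σ (RightView h r x) λ rv → O ≡ rightPart (evenTerm r) rv)

  module NonEmpty (hx≡H : h x ≡ H) (1≤H : 1 ≤ H) where

    reaches : ∀ {s} → s ≤ H → s ≤ h x
    reaches s≤H = subst (_ ≤_) (sym hx≡H) s≤H

    left-not-extremal : ∀ r p → Odd r → LeftNbr h (suc r) x p → ¬ ExtremalBlock h (suc r) x
    left-not-extremal r p odd _ (inj₁ (odd′ , _)) = odd-even-disjoint {suc r} odd′ (odd⇒even-suc r odd)
    left-not-extremal r p odd (p<x , _ , _ , r<hp , _) (inj₂ (_ , _ , left-low)) = <⇒≱ (left-low p p<x) r<hp

    right-not-extremal : ∀ r q → Even r → RightNbr h (suc r) x q → ¬ ExtremalBlock h (suc r) x
    right-not-extremal r q even (x<q , _ , _ , r<hq , _) (inj₁ (_ , _ , right-low)) = <⇒≱ (right-low q x<q) r<hq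
    right-not-extremal r q even _ (inj₂ (even′ , _)) = odd-even-disjoint {suc r} (even⇒odd-suc r even) even′

    cancel-h : (rv : RightView h 1 x) → hForm K x +ℤ rightPart (oddTerm 1) rv ≡ + 0
    cancel-h (hasRight q nbr@(x<q , _)) = begin
      hForm K x +ℤ oddTerm 1 x q ≡⟨ cong₂ _+ℤ_ hForm-at (oddTerm-right 1 q x<q) ⟩
      - κ x +ℤ κ (b x 1)         ≡⟨ cong (λ c → - κ x +ℤ κ c) (level1 x (reaches 1≤H) (right-not-extremal 0 q refl nbr)) ⟩
      - κ x +ℤ κ x               ≡⟨ +-inverseˡ (κ x) ⟩
      + 0                        ∎
      where open ≡-Reasoning
    cancel-h (noRight right-low) = trans (+ℤ-identityʳ (hForm K x)) (trans hForm-at (cong -_ κx≡0))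
      where
        -- if K = x, the last column lies right of x, so it would have height 0
        κx≡0 : κ x ≡ + 0
        κx≡0 with K == x in K≡x
        ... | false = refl
        ... | true = ⊥-elim (no-even-right-barrier boundary 0 (fromℕ t) refl 1≤H z≤n
                       λ j last≤j → ≤-pred (right-low j (<-≤-trans x<last last≤j)))
          where
            x<last : toℕ x < toℕ (fromℕ t)
            x<last = subst₂ _<_ (trans (sym (toℕ-inject₁ k)) (==⇒≡ K≡x)) (sym (toℕ-fromℕ t)) (toℕ<n k)

    cancel-left : ∀ r → Odd r → 1 ≤ r → suc r ≤ H → (lv : LeftView h r x) (lv′ : LeftView h (suc r) x) →
                  leftPart (oddTerm r) lv +ℤ leftPart (evenTerm (suc r)) lv′ ≡ + 0
    cancel-left r odd 1≤r r<H (noLeft _) (noLeft _) = refl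
    cancel-left r odd 1≤r r<H (noLeft left-low) (hasLeft p′ (p′<x , _ , _ , r<hp′ , _)) =
      ⊥-elim (<⇒≱ (left-low p′ p′<x) (<⇒≤ r<hp′))
    cancel-left r odd 1≤r r<H (hasLeft p (p<x , _ , _ , r≤hp , _)) (noLeft left-low) =
      ⊥-elim (no-odd-left-barrier boundary r p odd r<H r≤hp
                λ j j≤p → ≤-pred (left-low j (≤-<-trans j≤p p<x)))
    cancel-left r odd 1≤r r<H (hasLeft p nbr@(p<x , _)) (hasLeft p′ nbr′@(p′<x , _)) = begin
      oddTerm r p x +ℤ evenTerm (suc r) p′ x ≡⟨ cong₂ _+ℤ_ (oddTerm-left r p p<x) (evenTerm-left (suc r) p′ p′<x) ⟩
      κ (b p r) +ℤ - κ (b x (suc r))          ≡⟨ cong (λ c → κ (b p r) +ℤ - κ c) fill ⟩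
      κ (b p r) +ℤ - κ (b p r)                ≡⟨ +-inverseʳ (κ (b p r)) ⟩
      + 0                                      ∎
      where
        open ≡-Reasoning
        fill : b x (suc r) ≡ b p r
        fill = levelS x r p 1≤r (reaches r<H) (left-not-extremal r p′ odd nbr′) (inj₁ (odd , nbr))

    cancel-right : ∀ r → Even r → 1 ≤ r → suc r ≤ H → (rv : RightView h r x) (rv′ : RightView h (suc r) x) →
                   rightPart (evenTerm r) rv +ℤ rightPart (oddTerm (suc r)) rv′ ≡ + 0
    cancel-right r even 1≤r r<H (noRight _) (noRight _) = refl
    cancel-right r even 1≤r r<H (noRight right-low) (hasRight q′ (x<q′ , _ , _ , r<hq′ , _)) =
      ⊥-elim (<⇒≱ (right-low q′ x<q′) (<⇒≤ r<hq′))
    cancel-right r even 1≤r r<H (hasRight q (x<q , _ , _ , r≤hq , _)) (noRight right-low) =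
      ⊥-elim (no-even-right-barrier boundary r q even r<H r≤hq
                λ j q≤j → ≤-pred (right-low j (<-≤-trans x<q q≤j)))
    cancel-right r even 1≤r r<H (hasRight q nbr@(x<q , _)) (hasRight q′ nbr′@(x<q′ , _)) = begin
      evenTerm r x q +ℤ oddTerm (suc r) x q′ ≡⟨ cong₂ _+ℤ_ (evenTerm-right r q x<q) (oddTerm-right (suc r) q′ x<q′) ⟩
      - κ (b q r) +ℤ κ (b x (suc r))          ≡⟨ cong (λ c → - κ (b q r) +ℤ κ c) fill ⟩
      - κ (b q r) +ℤ κ (b q r)                ≡⟨ +-inverseˡ (κ (b q r)) ⟩
      + 0                                      ∎
      where
        open ≡-Reasoning
        fill : b x (suc r) ≡ b q r
        fill = levelS x r q 1≤r (reaches r<H) (right-not-extremal r q′ even nbr′) (inj₂ (even , nbr))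

    telescope : ∀ r → 1 ≤ r → r ≤ H → Σ ℤ λ O → Pending r O × hForm K x +ℤ sumRows h b r K x ≡ O
    telescope (suc zero) _ 1≤H′ with oddLevel 1 refl (reaches 1≤H′)
    ... | lv , rv , eq = L , inj₁ (refl , lv , refl) ,
      telescope-step (hForm K x) (+ 0) (fRow h b 1 K x) R L (+ℤ-identityʳ (hForm K x)) (trans eq (+-comm L R)) (cancel-h rv)
      where
        L = leftPart (oddTerm 1) lv
        R = rightPart (oddTerm 1) rv
    telescope (suc (suc r)) _ r+2≤H with telescope (suc r) (s≤s z≤n) (<⇒≤ r+2≤H)
    ... | O , inj₁ (odd , lv , O≡L) , sum≡O
      with evenLevel (suc (suc r)) (odd⇒even-suc (suc r) odd) (reaches r+2≤H)
    ...   | lv′ , rv′ , eq = R , inj₂ (odd⇒even-suc (suc r) odd , rv′ , refl) ,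
      telescope-step (hForm K x) (sumRows h b (suc r) K x) (fRow h b (suc (suc r)) K x) L R sum≡O eq
        (trans (cong (_+ℤ L) O≡L) (cancel-left (suc r) odd (s≤s z≤n) r+2≤H lv lv′))
      where
        L = leftPart (evenTerm (suc (suc r))) lv′
        R = rightPart (evenTerm (suc (suc r))) rv′
    telescope (suc (suc r)) _ r+2≤H | O , inj₂ (even , rv , O≡R) , sum≡O
      with oddLevel (suc (suc r)) (even⇒odd-suc (suc r) even) (reaches r+2≤H)
    ...   | lv′ , rv′ , eq = L , inj₁ (even⇒odd-suc (suc r) even , lv′ , refl) ,
      telescope-step (hForm K x) (sumRows h b (suc r) K x) (fRow h b (suc (suc r)) K x) R L sum≡O
        (trans eq (+-comm L R))
        (trans (cong (_+ℤ R) O≡R) (cancel-right (suc r) even (s≤s z≤n) r+2≤H rv rv′))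
      where
        L = leftPart (oddTerm (suc (suc r))) lv′
        R = rightPart (oddTerm (suc (suc r))) rv′

    top-odd : Odd H → (∀ j → toℕ j < toℕ x → h j ≢ H) → ∀ O → Pending H O → O ≡ + 0
    top-odd odd leftmost O (inj₁ (_ , noLeft _ , O≡0)) = O≡0
    top-odd odd leftmost O (inj₁ (_ , hasLeft p (p<x , _ , _ , H≤hp , _) , _)) =
      ⊥-elim (leftmost p p<x (≤-antisym (height-bound h p) H≤hp))
    top-odd odd leftmost O (inj₂ (even , _)) = ⊥-elim (odd-even-disjoint {H} odd even)

    top-even : Even H → (∀ j → toℕ x < toℕ j → h j ≢ H) → ∀ O → Pending H O → O ≡ + 0
    top-even even rightmost O (inj₂ (_ , noRight _ , O≡0)) = O≡0
    top-even even rightmost O (inj₂ (_ , hasRight q (x<q , _ , _ , H≤hq , _) , _)) =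
      ⊥-elim (rightmost q x<q (≤-antisym (height-bound h q) H≤hq))
    top-even even rightmost O (inj₁ (odd , _)) = ⊥-elim (odd-even-disjoint {H} odd even)

    odd-height : Odd H → (∀ j → toℕ j < toℕ x → h j ≢ H) → fT 𝒯 K x ≡ + 0
    odd-height odd leftmost with telescope H 1≤H ≤-refl
    ... | O , pending , fT≡O = trans fT≡O (top-odd odd leftmost O pending)

    even-height : Even H → (∀ j → toℕ x < toℕ j → h j ≢ H) → fT 𝒯 K x ≡ + 0
    even-height even rightmost with telescope H 1≤H ≤-refl
    ... | O , pending , fT≡O = trans fT≡O (top-even even rightmost O pending)


lemma5p4 : (t : ℕ) (𝒯 : Tableau (suc t)) (i : Fin (suc t)) →
    StronglyExtremal (Tableau.heights 𝒯) i →
    (k : Fin t) → fT 𝒯 (inject₁ k) i ≡ + 0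
lemma5p4 t 𝒯 i (inj₁ (H≡0 , i≡last)) k =
  Telescoping.empty-diagram t 𝒯 k i H≡0 i≡last
lemma5p4 t 𝒯 i (inj₂ (inj₁ (1≤H , odd , hi≡H , leftmost))) k =
  Telescoping.NonEmpty.odd-height t 𝒯 k i hi≡H 1≤H odd leftmost
lemma5p4 t 𝒯 i (inj₂ (inj₂ (1≤H , even , hi≡H , rightmost))) k =
  Telescoping.NonEmpty.even-height t 𝒯 k i hi≡H 1≤H even rightmost
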